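{- Let $H$ be a homogeneous relation on a finite set $X$ and let $A,B$ be homogeneous modules of $H$ that overlap. Then $A\cap B$ and $A\cup B$ are homogeneous modules of $H$.
   Context: A diverse triple of $X$ is $(x,y,z)\in X^3$ with $x\neq y$, $x\neq z$, written $(x|yz)$. A homogeneous relation $H$ on $X$ is a relation on diverse triples such that for every $x\in X$ the relation $H_x(y,z)\Leftrightarrow H(x|yz)$ is an equivalence relation on $X\setminus\{x\}$. $M\subseteq X$ is a homogeneous module if $H(x|mm')$ for all $m,m'\in M$, $x\in X\setminus M$. Sets $A,B$ overlap if $A\cap B$, $A\setminus B$, $B\setminus A$ are all non-empty. -}

module Defs where

open import Data.Nat using (ℕ)
open import Data.Fin using (Fin)
open import Data.Fin.Subset using (Subset; _∈_; _∉_; _∩_; _∪_)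
open import Data.Product using (∃; _×_)
open import Relation.Binary.PropositionalEquality using (_≢_)

-- A ternary relation on X = Fin n; H x y z is read as H(x|yz).
-- Its values on non-diverse triples (y ≡ x or z ≡ x) are irrelevant.
TernRel : ℕ → Set₁
TernRel n = Fin n → Fin n → Fin n → Set

record IsHomogeneous {n : ℕ} (H : TernRel n) : Set where
  field
    refl  : ∀ x y → x ≢ y → H x y y
    sym   : ∀ x y z → x ≢ y → x ≢ z → H x y z → H x z y
    trans : ∀ x y z w → x ≢ y → x ≢ z → x ≢ w → H x y z → H x z w → H x y w

IsModule : {n : ℕ} → TernRel n → Subset n → Set
IsModule H M = ∀ x m m′ → x ∉ M → m ∈ M → m′ ∈ M → H x m m′

Overlap : {n : ℕ} → Subset n → Subset n → Set
Overlap A B =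
  (∃ λ x → x ∈ A × x ∈ B) × (∃ λ x → x ∈ A × x ∉ B) × (∃ λ x → x ∈ B × x ∉ A)

module Submission where

open import Defs
open import Data.Nat using (ℕ)
open import Data.Fin using (Fin)
open import Data.Fin.Subset using (Subset; _∩_; _∪_; _∈_; _∉_)
open import Data.Fin.Subset.Properties using (_∈?_; x∈p∩q⁺; x∈p∩q⁻; x∈p∪q⁻; x∈p∪q⁺)
open import Data.Empty using (⊥-elim)
open import Data.Product using (∃; _×_; _,_)
open import Data.Sum using (_⊎_; inj₁; inj₂)
open import Relation.Nullary using (yes; no)
open import Relation.Binary.PropositionalEquality using (_≢_; subst; sym)

module _ {n : ℕ} {H : TernRel n} where

  ∉∧∈⇒≢ : ∀ {A : Subset n} {x m : Fin n} → x ∉ A → m ∈ A → x ≢ m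
  ∉∧∈⇒≢ {A} x∉A m∈A x≡m = x∉A (subst (_∈ A) (sym x≡m) m∈A)

  IsModule-∩ : ∀ {A B} → IsModule H A → IsModule H B → IsModule H (A ∩ B)
  IsModule-∩ {A} {B} modA modB x m m′ x∉A∩B m∈A∩B m′∈A∩B
    with x∈p∩q⁻ A B m∈A∩B | x∈p∩q⁻ A B m′∈A∩B | x ∈? A | x ∈? B
  ... | _ | _ | yes x∈A | yes x∈B = ⊥-elim (x∉A∩B (x∈p∩q⁺ (x∈A , x∈B)))
  ... | m∈A , _ | m′∈A , _ | no x∉A | _ = modA x m m′ x∉A m∈A m′∈A
  ... | _ , m∈B | _ , m′∈B | yes _ | no x∉B = modB x m m′ x∉B m∈B m′∈B

  -- A common element c links the two modules: H_x(a, c) and H_x(c, b) give H_x(a, b) by transitivity.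
  IsModule-∪ : IsHomogeneous H → ∀ {A B} → IsModule H A → IsModule H B →
               (∃ λ c → c ∈ A × c ∈ B) → IsModule H (A ∪ B)
  IsModule-∪ hom {A} {B} modA modB (c , c∈A , c∈B) x m m′ x∉A∪B m∈A∪B m′∈A∪B =
    relate (x∈p∪q⁻ A B m∈A∪B) (x∈p∪q⁻ A B m′∈A∪B)
    where
    open IsHomogeneous hom using (trans)
    x∉A : x ∉ A
    x∉A x∈A = x∉A∪B (x∈p∪q⁺ (inj₁ x∈A))
    x∉B : x ∉ B
    x∉B x∈B = x∉A∪B (x∈p∪q⁺ (inj₂ x∈B))
    relate : m ∈ A ⊎ m ∈ B → m′ ∈ A ⊎ m′ ∈ B → H x m m′
    relate (inj₁ m∈A) (inj₁ m′∈A) = modA x m m′ x∉A m∈A m′∈A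
    relate (inj₂ m∈B) (inj₂ m′∈B) = modB x m m′ x∉B m∈B m′∈B
    relate (inj₁ m∈A) (inj₂ m′∈B) =
      trans x m c m′ (∉∧∈⇒≢ x∉A m∈A) (∉∧∈⇒≢ x∉A c∈A) (∉∧∈⇒≢ x∉B m′∈B)
            (modA x m c x∉A m∈A c∈A) (modB x c m′ x∉B c∈B m′∈B)
    relate (inj₂ m∈B) (inj₁ m′∈A) =
      trans x m c m′ (∉∧∈⇒≢ x∉B m∈B) (∉∧∈⇒≢ x∉A c∈A) (∉∧∈⇒≢ x∉A m′∈A)
            (modB x m c x∉B m∈B c∈B) (modA x c m′ x∉A c∈A m′∈A)

proposition3 : (n : ℕ) (H : TernRel n) → IsHomogeneous H →
    (A B : Subset n) → IsModule H A → IsModule H B → Overlap A B →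
    IsModule H (A ∩ B) × IsModule H (A ∪ B)
proposition3 n H hom A B modA modB (A∩B≠∅ , _ , _) =
  IsModule-∩ modA modB , IsModule-∪ hom modA modB A∩B≠∅
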